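{- Let $Q$ be a connected quiver with two mutable vertices $1,2$ and one frozen vertex $u$, such that $|b_{12}|\ge2$. Then for any reduced mutation sequence $\mathbf M$ on $Q$, there are at most four values of $\ell$ such that $Q^{(\ell)}_{\mathbf M}$ is acyclic.
   Context: Quiver: finite directed graph without loops or oriented 2-cycles, vertices partitioned into mutable and frozen; $b_{ij}$ = #arrows $i\to j$ − #arrows $j\to i$; mutation $\mu_j$: for each path $i\xrightarrow{a}j\xrightarrow{b}k$ add $ab$ arrows $i\to k$, reverse arrows at $j$, cancel 2-cycles; $Q^{(0)}_{\mathbf M}=Q$, $Q^{(\ell)}_{\mathbf M}=\mu_{m_\ell}(Q^{(\ell-1)}_{\mathbf M})$. Reduced: $m_i\ne m_{i+1}$. Connected: mutable part connected and no isolated frozen vertices. Acyclic: no directed cycles. -}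

module Defs where

open import Data.Nat using (ℕ; zero; suc)
open import Data.Integer using (ℤ; _+_; _*_; -_; _⊔_; _<_; 0ℤ)
open import Data.Fin using (Fin; zero; suc; inject₁)
open import Data.Fin.Properties using (_≟_)
open import Data.List using (List; []; _∷_)
open import Relation.Nullary using (¬_; yes; no)
open import Relation.Binary.PropositionalEquality using (_≡_)
open import Data.Empty using (⊥)
open import Data.Unit using (⊤)
open import Data.Product using (_×_)

-- A quiver (no loops, no oriented 2-cycles) on the vertex set Fin n is
-- determined by its exchange matrix b i j = #(i→j) − #(j→i), which is
-- skew-symmetric.
Matrix : ℕ → Set
Matrix n = Fin n → Fin n → ℤ

SkewSymmetric : ∀ {n} → Matrix n → Set
SkewSymmetric {n} b = (i j : Fin n) → b j i ≡ - b i j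

[_]₊ : ℤ → ℤ
[ x ]₊ = x ⊔ 0ℤ

-- Quiver mutation at vertex j: for each path i →(a) j →(c) k add a·c arrows
-- i → k, reverse the arrows at j, cancel 2-cycles.
μ : ∀ {n} → Fin n → Matrix n → Matrix n
μ j b i k with i ≟ j | k ≟ j
... | yes _ | _     = - b i k
... | no _  | yes _ = - b i k
... | no _  | no _  = b i k + [ b i j ]₊ * [ b j k ]₊ + - ([ b k j ]₊ * [ b j i ]₊)

-- Setting of the proposition: vertices Fin 3, mutable vertices 1,2 are
-- Fin 3 elements 0,1 (i.e. inject₁ of Fin 2), frozen vertex u is 2.
v1 v2 u : Fin 3
v1 = zero
v2 = suc zero
u  = suc (suc zero)

Mutable : Set
Mutable = Fin 2

mutable : Mutable → Fin 3
mutable = inject₁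

mutSeq : Matrix 3 → List Mutable → Matrix 3
mutSeq b []       = b
mutSeq b (m ∷ ms) = mutSeq (μ (mutable m) b) ms

Reduced : List Mutable → Set
Reduced []             = ⊤
Reduced (m ∷ [])       = ⊤
Reduced (m ∷ m′ ∷ ms)  = (¬ m ≡ m′) × Reduced (m′ ∷ ms)

-- Connected: mutable part connected (b₁₂ ≠ 0) and the frozen vertex is not
-- isolated (there is an arrow between u and 1 or u and 2).
data FrozenNotIsolated (b : Matrix 3) : Set where
  via1 : ¬ b v1 u ≡ 0ℤ → FrozenNotIsolated b
  via2 : ¬ b v2 u ≡ 0ℤ → FrozenNotIsolated b

Connected : Matrix 3 → Set
Connected b = (¬ b v1 v2 ≡ 0ℤ) × FrozenNotIsolated b

-- Directed walks of length n in the quiver (an arrow i → j exists iff bᵢⱼ > 0).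
data Walk {n : ℕ} (b : Matrix n) : Fin n → Fin n → ℕ → Set where
  here : ∀ {i} → Walk b i i zero
  step : ∀ {i j k l} → 0ℤ < b i j → Walk b j k l → Walk b i k (suc l)

Acyclic : ∀ {n} → Matrix n → Set
Acyclic {n} b = (i : Fin n) (l : ℕ) → ¬ Walk b i i (suc l)

-- A reduced sequence alternates between the two mutable vertices, so every mutation reverses
-- the a-fold arrow between them (a = ∣b₁₂∣ ≥ 2) and always hits the same end of it. Reading the
-- two frozen arrows along the triangle through u, their weights (x , y) evolve by
-- (x , y) ↦ (y , a[y]₊ − x), and the quiver can only be acyclic when x and y are not both
-- positive. A potential Φ ≤ 4 never increases along this recurrence and drops at each such
-- pair, because a ≥ 2 makes the region 0 < x ≤ y absorbing.
{-# OPTIONS --safe #-}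
module Submission where

open import Defs
open import Data.Nat using (ℕ; zero; suc; _≤_; _<_; _≤ᵇ_; s≤s; z≤n; z<s; s<s)
import Data.Nat.Properties as ℕP
open import Data.Nat.GeneralisedArithmetic using (iterate)
open import Data.Integer as ℤ using (ℤ; +_; +[1+_]; -[1+_]; _+_; _*_; -_; _-_; 0ℤ; ∣_∣; +≤+; +<+)
import Data.Integer.Properties as ℤP
open import Data.Integer.Solver using (module +-*-Solver)
open import Data.Bool using (if_then_else_; true; false)
open import Data.Fin using (Fin; zero; suc)
open import Data.Fin.Properties using (_≟_)
open import Data.List using (List; []; _∷_; length; take; map)
open import Data.List.Properties using (length-map; length-removeAt′)
open import Data.List.Relation.Unary.All as All using (All; []; _∷_)
open import Data.List.Relation.Unary.Any using (here; there; _─_)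
open import Data.List.Relation.Unary.Unique.Propositional using (Unique; []; _∷_)
open import Data.List.Membership.Propositional using (_∈_)
open import Data.List.Membership.Propositional.Properties using (∈-map⁺)
open import Data.Product using (_×_; _,_; proj₂; ∃-syntax; swap)
open import Data.Sum as Sum using (_⊎_; inj₁; inj₂)
open import Data.Unit using (⊤; tt)
open import Function using (_∘_)
open import Relation.Binary.PropositionalEquality
open import Relation.Nullary using (¬_; yes; no; contradiction; ofʸ; ofⁿ)
open import Relation.Nullary.Decidable using (_×-dec_)
open import Relation.Unary using (Decidable)

∈-─⁺ : ∀ {a} {A : Set a} {x y : A} {xs} (x∈xs : x ∈ xs) → x ≢ y → y ∈ xs → y ∈ (xs ─ x∈xs)
∈-─⁺ (here refl)  x≢y (here refl)  = contradiction refl x≢y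
∈-─⁺ (here refl)  _   (there y∈xs) = y∈xs
∈-─⁺ (there _)    _   (here refl)  = here refl
∈-─⁺ (there x∈xs) x≢y (there y∈xs) = there (∈-─⁺ x∈xs x≢y y∈xs)

Unique⇒length≤ : ∀ {a} {A : Set a} {xs ys : List A} → Unique xs → All (_∈ ys) xs → length xs ≤ length ys
Unique⇒length≤ [] [] = z≤n
Unique⇒length≤ {xs = _ ∷ xs} {ys} (x≢xs ∷ unique) (x∈ys ∷ xs⊆ys) = begin
  suc (length xs)          ≤⟨ s≤s (Unique⇒length≤ unique xs⊆ys─x) ⟩
  suc (length (ys ─ x∈ys)) ≡⟨ length-removeAt′ ys _ ⟨
  length ys                ∎
  where
  open ℕP.≤-Reasoning
  xs⊆ys─x : All (_∈ (ys ─ x∈ys)) xs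
  xs⊆ys─x = All.zipWith (λ (x≢y , y∈ys) → ∈-─⁺ x∈ys x≢y y∈ys) (x≢xs , xs⊆ys)

-- [ y ]₊ comes first so that next computes on the constructors of y.
next : ℕ → ℤ × ℤ → ℤ × ℤ
next a (x , y) = y , [ y ]₊ * + a - x

BothPositive : ℤ × ℤ → Set
BothPositive (x , y) = 0ℤ ℤ.< x × 0ℤ ℤ.< y

bothPositive? : Decidable BothPositive
bothPositive? (x , y) = (0ℤ ℤP.<? x) ×-dec (0ℤ ℤP.<? y)

NonZeroPair : ℤ × ℤ → Set
NonZeroPair (x , y) = ¬ (x ≡ 0ℤ × y ≡ 0ℤ)

next-nonZero : ∀ {a s} → NonZeroPair s → NonZeroPair (next a s)
next-nonZero {s = _ , +[1+ _ ]} _ (() , _)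
next-nonZero {s = _ , -[1+ _ ]} _ (() , _)
next-nonZero {s = +[1+ _ ] , + 0} _ (_ , ())
next-nonZero {s = -[1+ _ ] , + 0} _ (_ , ())
next-nonZero {s = + 0 , + 0} nz _ = nz (refl , refl)

≤-next : ∀ {a x n} → 2 ≤ a → x ℤ.≤ +[1+ n ] → +[1+ n ] ℤ.≤ proj₂ (next a (x , +[1+ n ]))
≤-next {a} {x} {n} 2≤a x≤y = begin
  +[1+ n ]                  ≡⟨ ℤP.+-identityʳ _ ⟨
  +[1+ n ] + 0ℤ             ≤⟨ ℤP.+-monoʳ-≤ +[1+ n ] (ℤP.i≤j⇒0≤j-i x≤y) ⟩
  +[1+ n ] + (+[1+ n ] - x) ≡⟨ doubling +[1+ n ] x ⟩
  +[1+ n ] * + 2 - x        ≤⟨ ℤP.+-monoˡ-≤ (- x) (ℤP.*-monoˡ-≤-nonNeg +[1+ n ] (+≤+ 2≤a)) ⟩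
  +[1+ n ] * + a - x        ∎
  where
  open ℤP.≤-Reasoning
  open +-*-Solver
  doubling : ∀ y x → y + (y - x) ≡ y * + 2 - x
  doubling = solve 2 (λ y x → y :+ (y :- x) := y :* con (+ 2) :- x) refl

-- Outside the region 0 < x ≤ y, which it never leaves again, an orbit only moves forward along
--   (+ , ·) → (0 , −) → (− , ≤0) → (≤0 , +) → 0 < x ≤ y,
-- and Φ, the number of steps left, bounds the pairs to come that are not both positive.
Φ : ℤ × ℤ → ℕ
Φ (+[1+ x ] , +[1+ y ]) = if x ≤ᵇ y then 0 else 4
Φ (+[1+ _ ] , + 0)      = 4
Φ (+[1+ _ ] , -[1+ _ ]) = 4
Φ (+ 0      , -[1+ _ ]) = 3
Φ (-[1+ _ ] , -[1+ _ ]) = 2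
Φ (-[1+ _ ] , + 0)      = 2
Φ (+ 0      , +[1+ _ ]) = 1
Φ (-[1+ _ ] , +[1+ _ ]) = 1
Φ (+ 0      , + 0)      = 0

Φ≤4 : ∀ s → Φ s ≤ 4
Φ≤4 (+[1+ x ] , +[1+ y ]) with x ≤ᵇ y
... | true  = z≤n
... | false = ℕP.≤-refl
Φ≤4 (+[1+ _ ] , + 0)      = ℕP.≤-refl
Φ≤4 (+[1+ _ ] , -[1+ _ ]) = ℕP.≤-refl
Φ≤4 (+ 0      , -[1+ _ ]) = ℕP.n≤1+n 3
Φ≤4 (-[1+ _ ] , -[1+ _ ]) = s≤s (s≤s z≤n)
Φ≤4 (-[1+ _ ] , + 0)      = s≤s (s≤s z≤n)
Φ≤4 (+ 0      , +[1+ _ ]) = s≤s z≤n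
Φ≤4 (-[1+ _ ] , +[1+ _ ]) = s≤s z≤n
Φ≤4 (+ 0      , + 0)      = z≤n

Φ-increasing : ∀ {n z} → +[1+ n ] ℤ.≤ z → Φ (+[1+ n ] , z) ≡ 0
Φ-increasing {n} {+[1+ m ]} (+≤+ (s≤s n≤m)) with n ≤ᵇ m | ℕP.≤ᵇ-reflects-≤ n m
... | true  | _        = refl
... | false | ofⁿ n≰m = contradiction n≤m n≰m

Φ-next-absorbing : ∀ {a x n} → 2 ≤ a → x ℤ.≤ +[1+ n ] → Φ (next a (x , +[1+ n ])) ≡ 0
Φ-next-absorbing 2≤a x≤y = Φ-increasing (≤-next 2≤a x≤y)

Φ-next-bothPositive : ∀ {a s} → 2 ≤ a → BothPositive s → Φ (next a s) ≤ Φ s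
Φ-next-bothPositive {a} {+[1+ x ] , +[1+ y ]} 2≤a _ with x ≤ᵇ y | ℕP.≤ᵇ-reflects-≤ x y
... | true  | ofʸ x≤y = ℕP.≤-reflexive (Φ-next-absorbing 2≤a (+≤+ (s≤s x≤y)))
... | false | _       = Φ≤4 (next a (+[1+ x ] , +[1+ y ]))
Φ-next-bothPositive {s = + 0 , _}             _ (+<+ () , _)
Φ-next-bothPositive {s = -[1+ _ ] , _}        _ (() , _)
Φ-next-bothPositive {s = +[1+ _ ] , + 0}      _ (_ , +<+ ())
Φ-next-bothPositive {s = +[1+ _ ] , -[1+ _ ]} _ (_ , ())

Φ-next-notBothPositive : ∀ {a s} → 2 ≤ a → NonZeroPair s → ¬ BothPositive s → Φ (next a s) < Φ s
Φ-next-notBothPositive {s = +[1+ _ ] , +[1+ _ ]} _ _ ¬pos = contradiction (+<+ z<s , +<+ z<s) ¬pos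
Φ-next-notBothPositive {s = +[1+ _ ] , + 0}      _ _ _ = ℕP.≤-refl
Φ-next-notBothPositive {s = +[1+ _ ] , -[1+ _ ]} _ _ _ = s<s (s<s z<s)
Φ-next-notBothPositive {s = + 0      , -[1+ _ ]} _ _ _ = ℕP.≤-refl
Φ-next-notBothPositive {s = -[1+ _ ] , -[1+ _ ]} _ _ _ = ℕP.≤-refl
Φ-next-notBothPositive {s = -[1+ _ ] , + 0}      _ _ _ = ℕP.≤-refl
Φ-next-notBothPositive {s = + 0      , +[1+ _ ]} 2≤a _ _ = s≤s (ℕP.≤-reflexive (Φ-next-absorbing 2≤a (+≤+ z≤n)))
Φ-next-notBothPositive {s = -[1+ _ ] , +[1+ _ ]} 2≤a _ _ = s≤s (ℕP.≤-reflexive (Φ-next-absorbing 2≤a ℤ.-≤+))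
Φ-next-notBothPositive {s = + 0      , + 0}      _ nz _ = contradiction (refl , refl) nz

notBothPositive-indices : ∀ {a} → 2 ≤ a → ∀ n s → NonZeroPair s →
  ∃[ K ] (length K ≤ Φ s × (∀ {ℓ} → ℓ < n → ¬ BothPositive (iterate (next a) s ℓ) → ℓ ∈ K))
notBothPositive-indices _ zero _ _ = [] , z≤n , λ ()
notBothPositive-indices {a} 2≤a (suc n) s nz
  with K , |K|≤Φ , covers ← notBothPositive-indices 2≤a n (next a s) (next-nonZero nz)
  with bothPositive? s
... | yes pos = map suc K , |sucK|≤Φ , covers-pos
  where
  |sucK|≤Φ : length (map suc K) ≤ Φ s
  |sucK|≤Φ = begin
    length (map suc K) ≡⟨ length-map suc K ⟩
    length K           ≤⟨ |K|≤Φ ⟩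
    Φ (next a s)       ≤⟨ Φ-next-bothPositive 2≤a pos ⟩
    Φ s                ∎
    where open ℕP.≤-Reasoning
  covers-pos : ∀ {ℓ} → ℓ < suc n → ¬ BothPositive (iterate (next a) s ℓ) → ℓ ∈ map suc K
  covers-pos {zero}  _         ¬pos = contradiction pos ¬pos
  covers-pos {suc _} (s<s ℓ<n) ¬pos = ∈-map⁺ suc (covers ℓ<n ¬pos)
... | no ¬pos = 0 ∷ map suc K , |0∷sucK|≤Φ , covers-¬pos
  where
  |0∷sucK|≤Φ : length (0 ∷ map suc K) ≤ Φ s
  |0∷sucK|≤Φ = begin
    suc (length (map suc K)) ≡⟨ cong suc (length-map suc K) ⟩
    suc (length K)           ≤⟨ s≤s |K|≤Φ ⟩
    suc (Φ (next a s))       ≤⟨ Φ-next-notBothPositive 2≤a nz ¬pos ⟩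
    Φ s                      ∎
    where open ℕP.≤-Reasoning
  covers-¬pos : ∀ {ℓ} → ℓ < suc n → ¬ BothPositive (iterate (next a) s ℓ) → ℓ ∈ 0 ∷ map suc K
  covers-¬pos {zero}  _         _      = here refl
  covers-¬pos {suc _} (s<s ℓ<n) ¬pos′ = there (∈-map⁺ suc (covers ℓ<n ¬pos′))

module _ {n} (j : Fin n) (b : Matrix n) where

  μ-row : ∀ k → μ j b j k ≡ - b j k
  μ-row k with j ≟ j | k ≟ j
  ... | yes _ | _     = refl
  ... | no j≢j | _    = contradiction refl j≢j

  μ-col : ∀ i → μ j b i j ≡ - b i j
  μ-col i with i ≟ j | j ≟ j
  ... | yes _ | _      = refl
  ... | no _  | yes _  = refl
  ... | no _  | no j≢j = contradiction refl j≢j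

  μ-off : ∀ {i k} → i ≢ j → k ≢ j → μ j b i k ≡ b i k + [ b i j ]₊ * [ b j k ]₊ + - ([ b k j ]₊ * [ b j i ]₊)
  μ-off {i} {k} i≢j k≢j with i ≟ j | k ≟ j
  ... | yes i≡j | _       = contradiction i≡j i≢j
  ... | no _    | yes k≡j = contradiction k≡j k≢j
  ... | no _    | no _    = refl

μ-skewSymmetric : ∀ {n} (j : Fin n) {b : Matrix n} → SkewSymmetric b → SkewSymmetric (μ j b)
μ-skewSymmetric j {b} skew i k with i ≟ j | k ≟ j
... | yes _ | yes _ = cong -_ (skew i k)
... | yes _ | no _  = cong -_ (skew i k)
... | no _  | yes _ = cong -_ (skew i k)
... | no _  | no _  = begin
  b k i + [ b k j ]₊ * [ b j i ]₊ + - ([ b i j ]₊ * [ b j k ]₊)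
    ≡⟨ cong (λ z → z + [ b k j ]₊ * [ b j i ]₊ + - ([ b i j ]₊ * [ b j k ]₊)) (skew i k) ⟩
  - b i k + [ b k j ]₊ * [ b j i ]₊ + - ([ b i j ]₊ * [ b j k ]₊)
    ≡⟨ neg-rearrange (b i k) _ _ ⟩
  - (b i k + [ b i j ]₊ * [ b j k ]₊ + - ([ b k j ]₊ * [ b j i ]₊))
    ∎
  where
  open ≡-Reasoning
  open +-*-Solver
  neg-rearrange : ∀ x y z → - x + y + - z ≡ - (x + z + - y)
  neg-rearrange = solve 3 (λ x y z → :- x :+ y :+ :- z := :- (x :+ z :+ :- y)) refl

-- Weights of t → w and w → s, the other two sides of the triangle s → t → w → s.
cycleWeights : ∀ {n} → Fin n → Fin n → Fin n → Matrix n → ℤ × ℤ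
cycleWeights s t w b = b t w , b w s

triangle⇒¬acyclic : ∀ {n} {b : Matrix n} {s t w} → 0ℤ ℤ.< b s t → BothPositive (cycleWeights s t w b) → ¬ Acyclic b
triangle⇒¬acyclic st (tw , ws) acyclic = acyclic _ 2 (step st (step tw (step ws here)))

cycleWeights-nonZero : ∀ {n} {b : Matrix n} {s t w} → SkewSymmetric b →
  b s w ≢ 0ℤ ⊎ b t w ≢ 0ℤ → NonZeroPair (cycleWeights s t w b)
cycleWeights-nonZero {s = s} {w = w} skew (inj₁ sw≢0) (_ , ws≡0) = sw≢0 (trans (skew w s) (cong -_ ws≡0))
cycleWeights-nonZero skew (inj₂ tw≢0) (tw≡0 , _) = tw≢0 tw≡0

module _ {n} {b : Matrix n} (skew : SkewSymmetric b) {s t : Fin n} {a} (st≡a : b s t ≡ + a) where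

  private
    ts≡-a : b t s ≡ - + a
    ts≡-a = trans (skew s t) (cong -_ st≡a)

    -ts≡a : - b t s ≡ + a
    -ts≡a = trans (cong -_ ts≡-a) (ℤP.neg-involutive (+ a))

    [st]₊≡a : [ b s t ]₊ ≡ + a
    [st]₊≡a = trans (cong [_]₊ st≡a) (ℤP.i≥j⇒i⊔j≡i (+≤+ z≤n))

    [ts]₊≡0 : [ b t s ]₊ ≡ 0ℤ
    [ts]₊≡0 = trans (cong [_]₊ ts≡-a) (ℤP.i≤j⇒i⊔j≡j ℤP.neg-≤-pos)

  μ-source-arrow : μ s b t s ≡ + a
  μ-source-arrow = trans (μ-col s b t) -ts≡a

  μ-target-arrow : μ t b t s ≡ + a
  μ-target-arrow = trans (μ-row t b s) -ts≡a

  module _ {w : Fin n} (t≢s : t ≢ s) (w≢s : w ≢ s) (w≢t : w ≢ t) where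

    μ-source-cycleWeights : cycleWeights t s w (μ s b) ≡ next a (cycleWeights s t w b)
    μ-source-cycleWeights = cong₂ _,_ (trans (μ-row s b w) (sym (skew s w))) new-wt
      where
      open ≡-Reasoning
      new-wt : μ s b w t ≡ [ b w s ]₊ * + a - b t w
      new-wt = begin
        μ s b w t
          ≡⟨ μ-off s b w≢s t≢s ⟩
        b w t + [ b w s ]₊ * [ b s t ]₊ + - ([ b t s ]₊ * [ b s w ]₊)
          ≡⟨ cong₂ (λ p q → b w t + [ b w s ]₊ * p + - (q * [ b s w ]₊)) [st]₊≡a [ts]₊≡0 ⟩
        b w t + [ b w s ]₊ * + a + 0ℤ
          ≡⟨ ℤP.+-identityʳ _ ⟩
        b w t + [ b w s ]₊ * + a
          ≡⟨ cong (_+ [ b w s ]₊ * + a) (skew t w) ⟩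
        - b t w + [ b w s ]₊ * + a
          ≡⟨ ℤP.+-comm (- b t w) _ ⟩
        [ b w s ]₊ * + a - b t w
          ∎

    μ-target-cycleWeights : swap (cycleWeights t s w (μ t b)) ≡ next a (swap (cycleWeights s t w b))
    μ-target-cycleWeights = cong₂ _,_ new-wt new-sw
      where
      open ≡-Reasoning
      new-wt : μ t b w t ≡ b t w
      new-wt = trans (μ-col t b w) (trans (cong -_ (skew t w)) (ℤP.neg-involutive (b t w)))
      new-sw : μ t b s w ≡ [ b t w ]₊ * + a - b w s
      new-sw = begin
        μ t b s w
          ≡⟨ μ-off t b (t≢s ∘ sym) w≢t ⟩
        b s w + [ b s t ]₊ * [ b t w ]₊ + - ([ b w t ]₊ * [ b t s ]₊)
          ≡⟨ cong₂ (λ p q → b s w + p * [ b t w ]₊ + - ([ b w t ]₊ * q)) [st]₊≡a [ts]₊≡0 ⟩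
        b s w + + a * [ b t w ]₊ + - ([ b w t ]₊ * 0ℤ)
          ≡⟨ cong (λ z → b s w + + a * [ b t w ]₊ + - z) (ℤP.*-zeroʳ [ b w t ]₊) ⟩
        b s w + + a * [ b t w ]₊ + 0ℤ
          ≡⟨ ℤP.+-identityʳ _ ⟩
        b s w + + a * [ b t w ]₊
          ≡⟨ cong₂ _+_ (skew w s) (ℤP.*-comm (+ a) _) ⟩
        - b w s + [ b t w ]₊ * + a
          ≡⟨ ℤP.+-comm (- b w s) _ ⟩
        [ b t w ]₊ * + a - b w s
          ∎

other : Mutable → Mutable
other zero       = suc zero
other (suc zero) = zero

≢⇒≡other : ∀ {k m : Mutable} → k ≢ m → m ≡ other k
≢⇒≡other {zero}     {zero}     k≢m = contradiction refl k≢m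
≢⇒≡other {zero}     {suc zero} _   = refl
≢⇒≡other {suc zero} {zero}     _   = refl
≢⇒≡other {suc zero} {suc zero} k≢m = contradiction refl k≢m

Alternating : Mutable → List Mutable → Set
Alternating k []      = ⊤
Alternating k (m ∷ M) = m ≡ k × Alternating (other k) M

Reduced⇒Alternating-head : ∀ m M → Reduced (m ∷ M) → Alternating m (m ∷ M)
Reduced⇒Alternating-head m []      _            = refl , tt
Reduced⇒Alternating-head m (m′ ∷ M) (m≢m′ , red) with ≢⇒≡other m≢m′
... | refl = refl , Reduced⇒Alternating-head (other m) M red

Reduced⇒Alternating : ∀ {M} → Reduced M → ∃[ k ] Alternating k M
Reduced⇒Alternating {[]}    _   = zero , tt
Reduced⇒Alternating {m ∷ M} red = m , Reduced⇒Alternating-head m M red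

-- Each mutation reverses the multiple arrow between the mutable vertices, so along an
-- alternating sequence the mutated vertex is always its source or always its target.
data End : Set where
  source target : End

Oriented : End → Mutable → Matrix 3 → ℕ → Set
Oriented source k b a = b (mutable k) (mutable (other k)) ≡ + a
Oriented target k b a = b (mutable (other k)) (mutable k) ≡ + a

frozenPair : End → Mutable → Matrix 3 → ℤ × ℤ
frozenPair source k b = cycleWeights (mutable k) (mutable (other k)) u b
frozenPair target k b = swap (cycleWeights (mutable (other k)) (mutable k) u b)

Oriented-∣b₁₂∣ : ∀ {b} → SkewSymmetric b → ∀ k → ∃[ e ] Oriented e k b ∣ b v1 v2 ∣
Oriented-∣b₁₂∣ {b} skew k with ℤP.+∣i∣≡i⊎+∣i∣≡-i (b v1 v2) | k
... | inj₁ |b₁₂|≡b₁₂  | zero     = source , sym |b₁₂|≡b₁₂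
... | inj₁ |b₁₂|≡b₁₂  | suc zero = target , sym |b₁₂|≡b₁₂
... | inj₂ |b₁₂|≡-b₁₂ | zero     = target , trans (skew v1 v2) (sym |b₁₂|≡-b₁₂)
... | inj₂ |b₁₂|≡-b₁₂ | suc zero = source , trans (skew v1 v2) (sym |b₁₂|≡-b₁₂)

mutate-frozenPair : ∀ {b a} e k → SkewSymmetric b → Oriented e k b a →
  Oriented e (other k) (μ (mutable k) b) a × frozenPair e (other k) (μ (mutable k) b) ≡ next a (frozenPair e k b)
mutate-frozenPair source zero skew o =
  μ-source-arrow skew o , μ-source-cycleWeights skew o (λ ()) (λ ()) (λ ())
mutate-frozenPair source (suc zero) skew o =
  μ-source-arrow skew o , μ-source-cycleWeights skew o (λ ()) (λ ()) (λ ())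
mutate-frozenPair target zero skew o =
  μ-target-arrow skew o , μ-target-cycleWeights skew o (λ ()) (λ ()) (λ ())
mutate-frozenPair target (suc zero) skew o =
  μ-target-arrow skew o , μ-target-cycleWeights skew o (λ ()) (λ ()) (λ ())

FrozenNotIsolated⇒adjacent : ∀ {b} → FrozenNotIsolated b → ∀ k → b (mutable k) u ≢ 0ℤ ⊎ b (mutable (other k)) u ≢ 0ℤ
FrozenNotIsolated⇒adjacent (via1 1u≢0) zero       = inj₁ 1u≢0
FrozenNotIsolated⇒adjacent (via2 2u≢0) zero       = inj₂ 2u≢0
FrozenNotIsolated⇒adjacent (via1 1u≢0) (suc zero) = inj₂ 1u≢0
FrozenNotIsolated⇒adjacent (via2 2u≢0) (suc zero) = inj₁ 2u≢0

frozenPair-nonZero : ∀ {b} → SkewSymmetric b → FrozenNotIsolated b → ∀ e k → NonZeroPair (frozenPair e k b)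
frozenPair-nonZero skew frozen source k = cycleWeights-nonZero skew (FrozenNotIsolated⇒adjacent frozen k)
frozenPair-nonZero skew frozen target k = cycleWeights-nonZero skew (Sum.swap (FrozenNotIsolated⇒adjacent frozen k)) ∘ swap

frozenPair-bothPositive⇒¬acyclic : ∀ {b a} e k → 0 < a → Oriented e k b a → BothPositive (frozenPair e k b) → ¬ Acyclic b
frozenPair-bothPositive⇒¬acyclic source k 0<a o pos = triangle⇒¬acyclic (subst (0ℤ ℤ.<_) (sym o) (+<+ 0<a)) pos
frozenPair-bothPositive⇒¬acyclic target k 0<a o pos = triangle⇒¬acyclic (subst (0ℤ ℤ.<_) (sym o) (+<+ 0<a)) (swap pos)

acyclic⇒¬bothPositive : ∀ {b a} e k M → SkewSymmetric b → 0 < a → Oriented e k b a → Alternating k M →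
  ∀ {ℓ} → ℓ ≤ length M → Acyclic (mutSeq b (take ℓ M)) → ¬ BothPositive (iterate (next a) (frozenPair e k b) ℓ)
acyclic⇒¬bothPositive e k M       skew 0<a o _          {zero}  _         acyclic pos =
  frozenPair-bothPositive⇒¬acyclic e k 0<a o pos acyclic
acyclic⇒¬bothPositive {a = a} e k (_ ∷ M) skew 0<a o (refl , alt) {suc ℓ} (s≤s ℓ≤|M|) acyclic
  with o′ , frozenPair-next ← mutate-frozenPair e k skew o =
  subst (λ s → ¬ BothPositive (iterate (next a) s ℓ)) frozenPair-next
    (acyclic⇒¬bothPositive e (other k) M (μ-skewSymmetric (mutable k) skew) 0<a o′ alt ℓ≤|M| acyclic)

proposition6p16 : (b : Matrix 3) → SkewSymmetric b → Connected b →
    2 ≤ ∣ b v1 v2 ∣ →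
    (M : List Mutable) → Reduced M →
    (L : List ℕ) → Unique L →
    All (λ ℓ → ℓ ≤ length M × Acyclic (mutSeq b (take ℓ M))) L →
    length L ≤ 4
proposition6p16 b skew (_ , frozen) 2≤∣b₁₂∣ M reduced L unique acyclicAt
  with k , alternating ← Reduced⇒Alternating reduced
  with e , oriented ← Oriented-∣b₁₂∣ skew k
  with K , |K|≤Φ , covers ← notBothPositive-indices 2≤∣b₁₂∣ (suc (length M)) (frozenPair e k b)
                                                   (frozenPair-nonZero skew frozen e k)
  = begin
    length L             ≤⟨ Unique⇒length≤ unique (All.map covered acyclicAt) ⟩
    length K             ≤⟨ |K|≤Φ ⟩
    Φ (frozenPair e k b) ≤⟨ Φ≤4 (frozenPair e k b) ⟩
    4                    ∎
  where
  open ℕP.≤-Reasoning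
  covered : ∀ {ℓ} → ℓ ≤ length M × Acyclic (mutSeq b (take ℓ M)) → ℓ ∈ K
  covered (ℓ≤|M| , acyclic) =
    covers (s≤s ℓ≤|M|)
      (acyclic⇒¬bothPositive e k M skew (ℕP.<-≤-trans z<s 2≤∣b₁₂∣) oriented alternating ℓ≤|M| acyclic)
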